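{- Let $d \ge 2$ and let $W^d$ be the join of a set of $3$ points with a $(d-1)$-simplex; explicitly, $W^d$ is the pure $d$-dimensional simplicial complex on vertex set $\{1,\dots,d+3\}$ whose facets are the three sets $\{1,\dots,d\}\cup\{a\}$ for $a \in \{d+1,d+2,d+3\}$. Then: (a) $W^d$ admits no weakly-Hamiltonian path and no weakly-Hamiltonian cycle (hence no tight- or loose-Hamiltonian path or cycle); (b) for every $(d+1)$-element subset $F \subseteq \{1,\dots,d+3\}$ that is not a facet of $W^d$, the pure $d$-complex whose facets are those of $W^d$ together with $F$ admits a weakly-Hamiltonian cycle. In other words, $W^d$ is maximal with respect to not having weakly-Hamiltonian cycles, yet it has no (tight, loose, or weak) Hamiltonian path.
   Context: Let $\Delta$ be a pure $d$-dimensional simplicial complex on $n$ vertices. For a labeling of the vertices of $\Delta$ by $1,\dots,n$ and an integer $i$, let $H_i$ denote the $d$-face with vertices $i, i+1, \dots, i+d$, where the sums are taken modulo $n$. A weakly-Hamiltonian path in $\Delta$ is a labeling of the vertices by $1,\dots,n$ together with indices $1 = i_1 < i_2 < \dots < i_k = n-d$ such that every $H_{i_j}$ is a facet of $\Delta$ and $i_{j+1} - i_j \le d$ for all $j$. A weakly-Hamiltonian cycle in $\Delta$ is a labeling of the vertices by $1,\dots,n$ together with indices $1 \le i_1 < \dots < i_k \le n$ such that every $H_{i_j}$ is a facet of $\Delta$, the union of the $H_{i_j}$ is the whole vertex set, $H_{i_j} \cap H_{i_{j+1}} \neq \emptyset$ for all $j<k$, and $H_{i_k} \cap H_{i_1}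 \ne \emptyset$. Tight- and loose-Hamiltonian paths/cycles are special cases of weakly-Hamiltonian ones, so the absence of weakly-Hamiltonian paths/cycles implies the absence of the other kinds. -}

module Defs where

open import Data.Nat using (ℕ; suc; _+_; _∸_; _<_; _≤_; _<ᵇ_; NonZero)
open import Data.Nat.DivMod using (_mod_)
open import Data.Fin using (Fin; toℕ)
open import Data.Fin.Subset using (Subset; ⋃; ⁅_⁆; _∪_; _∩_; Nonempty) renaming (⊤ to Full)
open import Data.Fin.Permutation using (Permutation′; _⟨$⟩ʳ_)
open import Data.List using (List; []; _∷_; map; upTo; head; last)
open import Data.List.Membership.Propositional using (_∈_)
open import Data.List.Relation.Unary.All using (All)
open import Data.List.Relation.Unary.Linked using (Linked)
open import Data.Maybe using (Maybe; just)
open import Data.Product using (_×_)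
open import Data.Vec using (tabulate)
open import Relation.Binary.PropositionalEquality using (_≡_)

-- Vertices are Fin n (0-based: vertex v stands for v+1).
-- A pure complex is given by its list of facets (as subsets of the vertex set).
Complex : ℕ → Set
Complex n = List (Subset n)

IsFacet : ∀ {n} → Complex n → Subset n → Set
IsFacet Δ F = F ∈ Δ

-- A labeling: π ⟨$⟩ʳ ℓ is the vertex carrying label ℓ (labels 0..n-1 stand for 1..n).
Labeling : ℕ → Set
Labeling n = Permutation′ n

-- H_i = vertices with labels i, i+1, ..., i+d (mod n), 0-based index i.
H : (d : ℕ) {n : ℕ} .{{_ : NonZero n}} → Labeling n → ℕ → Subset n
H d π i = ⋃ (map (λ k → ⁅ π ⟨$⟩ʳ ((i + k) mod _) ⁆) (upTo (suc d)))

-- Weakly-Hamiltonian path (0-based: 1 = i₁ < ... < i_k = n-d becomes 0 = i₁ < ... < i_k = n-d-1).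
record WeakHamPath (d : ℕ) {n : ℕ} .{{_ : NonZero n}} (Δ : Complex n) : Set where
  field
    lab     : Labeling n
    indices : List ℕ
    first   : head indices ≡ just 0
    final   : last indices ≡ just (n ∸ d ∸ 1)
    steps   : Linked (λ a b → a < b × b ≤ a + d) indices
    facets  : All (λ i → IsFacet Δ (H d lab i)) indices

-- Weakly-Hamiltonian cycle (0-based: 1 ≤ i₁ < ... < i_k ≤ n becomes 0 ≤ i₁ < ... < i_k < n).
record WeakHamCycle (d : ℕ) {n : ℕ} .{{_ : NonZero n}} (Δ : Complex n) : Set where
  field
    lab      : Labeling n
    indices  : List ℕ
    bounded  : All (λ i → i < n) indices
    increasing : Linked _<_ indices
    facets   : All (λ i → IsFacet Δ (H d lab i)) indices
    covers   : ⋃ (map (H d lab) indices) ≡ Full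
    overlaps : Linked (λ a b → Nonempty (H d lab a ∩ H d lab b)) indices
    closes   : ∀ a b → head indices ≡ just a → last indices ≡ just b →
               Nonempty (H d lab b ∩ H d lab a)

-- W^d on vertices 0..d+2: facets {0..d-1} ∪ {a} for a ∈ {d, d+1, d+2}.
base : (d : ℕ) → Subset (3 + d)
base d = tabulate (λ v → toℕ v <ᵇ d)

vtx : (d k : ℕ) → Fin (3 + d)
vtx d k = (d + k) mod (3 + d)

W : (d : ℕ) → Complex (3 + d)
W d = (base d ∪ ⁅ vtx d 0 ⁆) ∷ (base d ∪ ⁅ vtx d 1 ⁆) ∷ (base d ∪ ⁅ vtx d 2 ⁆) ∷ []

WPlus : (d : ℕ) → Subset (3 + d) → Complex (3 + d)
WPlus d F = F ∷ W d

module Submission where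

-- A window H i of a labeling of the d+3 vertices misses exactly the two vertices labelled
-- i+d+1 and i+d+2 (mod d+3), which are cyclically adjacent labels, while a facet of W^d misses
-- exactly two of the three apices.
--
-- No cycle: each apex lies in a covering window and in only one facet, so every facet of W^d
-- is a window of the cycle; hence the labels of any two apices are adjacent, and three pairwise
-- adjacent labels do not exist on a cycle of length d+3 ≥ 4.
-- No path: a path starts with window 0 and ends with window 2, which together contain every
-- vertex, whereas any two facets of W^d miss a common apex.
-- Maximality: a (d+1)-set F that is not a facet misses two vertices that are not both apices,
-- so some facet misses two other vertices. Labelling these four vertices as the gaps of windows
-- 0 and 2 turns those windows into F and that facet, and the two windows form a weakly-Hamiltonian
-- cycle: together they contain every label and both contain label 2.

open import Defs
open import Data.Nat using (ℕ; _<ᵇ_; suc; _+_; _∸_; _≤_; _<_; z≤n; s≤s; s≤s⁻¹; NonZero; _≤?_; _<?_)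
open import Data.Nat.Properties
open import Data.Nat.DivMod using (_mod_; _%_; m%n<n; m<n⇒m%n≡m; %-distribˡ-+; m%n%n≡m%n; n%n≡0; [m+n]%n≡m%n; m≤n⇒[n∸m]%m≡n%m)
open import Data.Fin using (Fin; toℕ; fromℕ<) renaming (suc to sucF)
open import Data.Fin.Patterns using (0F; 1F; 2F)
open import Data.Fin.Properties using (toℕ-fromℕ<; toℕ-injective; toℕ<n; all?; any?) renaming (_≟_ to _≟ᶠ_)
open import Data.Fin.Subset using (Subset; inside; outside; ∣_∣; ⋃; ⁅_⁆; _∪_; ∁; ⊥; _⊆_) renaming (_∈_ to _∈ₛ_; _∉_ to _∉ₛ_)
open import Data.Fin.Subset.Properties using (∉⊥; ∈⊤; ⊆⊤; ⊆-antisym; x∈⁅x⁆; x∈⁅y⁆⇒x≡y; x∈p∪q⁺; x∈p∪q⁻; x∈p∩q⁺; x∈∁p⇒x∉p; x∉p⇒x∈∁p; ∁p⊆∁q⇒p⊇q; ∣∁p∣≡n∸∣p∣; ∪-comm; ∪-identityˡ)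
open import Data.Fin.Permutation using (Permutation′; _⟨$⟩ʳ_; _⟨$⟩ˡ_; inverseˡ; inverseʳ; transpose; _∘ₚ_) renaming (id to idₚ)
import Data.Fin.Permutation.Components as PC
open import Data.List using (List; []; _∷_; map; head; last; length)
open import Data.List.Membership.Propositional using (_∈_; _∉_)
open import Data.List.Membership.Propositional.Properties using (∈-map⁺; ∈-map⁻; ∈-upTo⁺; ∈-upTo⁻)
open import Data.List.Relation.Unary.Any using (here; there)
open import Data.List.Relation.Unary.All using (All; []; _∷_) renaming (lookup to lookupᴬ)
open import Data.List.Relation.Unary.AllPairs using ([]; _∷_)
open import Data.List.Relation.Unary.Unique.Propositional using (Unique)
open import Data.List.Relation.Unary.Linked using ([-]; _∷_)
open import Data.List.Relation.Binary.Pointwise using (Pointwise; []; _∷_)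
open import Data.Maybe using (just)
open import Data.Vec using () renaming ([] to []ᵛ; _∷_ to _∷ᵛ_)
open import Data.Vec.Properties using ([]=⇒lookup; lookup⇒[]=; lookup∘tabulate)
open import Data.Bool.Properties using (T-≡)
open import Function.Bundles using (Equivalence)
open import Data.Product using (_×_; _,_; ∃; ∃₂; proj₁; proj₂)
open import Data.Sum using (_⊎_; inj₁; inj₂)
open import Data.Empty using (⊥-elim) renaming (⊥ to Empty)
open import Relation.Nullary using (¬_; Dec; yes; no)
open import Function using (_∘_)
open import Relation.Nullary.Decidable using (from-yes; ¬?; _×-dec_; _→-dec_; _⊎-dec_)
open import Relation.Binary.PropositionalEquality using (_≡_; _≢_; refl; sym; trans; cong; cong₂; subst; ≢-sym; module ≡-Reasoning)

private variable
  n : ℕ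

∈⁅x⁆∪⁅y⁆⁻ : ∀ {x y v : Fin n} → v ∈ₛ ⁅ x ⁆ ∪ ⁅ y ⁆ → v ≡ x ⊎ v ≡ y
∈⁅x⁆∪⁅y⁆⁻ {x = x} {y} m with x∈p∪q⁻ ⁅ x ⁆ ⁅ y ⁆ m
... | inj₁ p = inj₁ (x∈⁅y⁆⇒x≡y x p)
... | inj₂ q = inj₂ (x∈⁅y⁆⇒x≡y y q)

∈⋃⁺ : ∀ (ss : List (Subset n)) {s v} → s ∈ ss → v ∈ₛ s → v ∈ₛ ⋃ ss
∈⋃⁺ (s ∷ ss) (here refl) v∈s = x∈p∪q⁺ (inj₁ v∈s)
∈⋃⁺ (s ∷ ss) (there s∈ss) v∈s = x∈p∪q⁺ (inj₂ (∈⋃⁺ ss s∈ss v∈s))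

∈⋃⁻ : ∀ (ss : List (Subset n)) {v} → v ∈ₛ ⋃ ss → ∃ λ s → s ∈ ss × v ∈ₛ s
∈⋃⁻ [] v∈⊥ = ⊥-elim (∉⊥ v∈⊥)
∈⋃⁻ (s ∷ ss) v∈ with x∈p∪q⁻ s (⋃ ss) v∈
... | inj₁ v∈s = s , here refl , v∈s
... | inj₂ v∈⋃ with ∈⋃⁻ ss v∈⋃
...   | t , t∈ss , v∈t = t , there t∈ss , v∈t

∁-injective : ∀ {p q : Subset n} → ∁ p ≡ ∁ q → p ≡ q
∁-injective {p = p} {q} eq =
  ⊆-antisym (∁p⊆∁q⇒p⊇q (λ v∈ → subst (_ ∈ₛ_) (sym eq) v∈)) (∁p⊆∁q⇒p⊇q (λ v∈ → subst (_ ∈ₛ_) eq v∈))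

∁≡⁅x⁆∪⁅y⁆ : ∀ {p : Subset n} {x y} → x ∉ₛ p → y ∉ₛ p → (∀ v → v ∉ₛ p → v ≡ x ⊎ v ≡ y) → ∁ p ≡ ⁅ x ⁆ ∪ ⁅ y ⁆
∁≡⁅x⁆∪⁅y⁆ {p = p} {x} {y} x∉p y∉p only = ⊆-antisym ∁p⊆ ⊆∁p
  where
  ∁p⊆ : ∁ p ⊆ ⁅ x ⁆ ∪ ⁅ y ⁆
  ∁p⊆ {v} v∈ with only v (x∈∁p⇒x∉p v∈)
  ... | inj₁ refl = x∈p∪q⁺ (inj₁ (x∈⁅x⁆ x))
  ... | inj₂ refl = x∈p∪q⁺ (inj₂ (x∈⁅x⁆ y))
  ⊆∁p : ⁅ x ⁆ ∪ ⁅ y ⁆ ⊆ ∁ p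
  ⊆∁p v∈ with ∈⁅x⁆∪⁅y⁆⁻ v∈
  ... | inj₁ refl = x∉p⇒x∈∁p x∉p
  ... | inj₂ refl = x∉p⇒x∈∁p y∉p

∣p∣≡0⇒p≡⊥ : ∀ (p : Subset n) → ∣ p ∣ ≡ 0 → p ≡ ⊥
∣p∣≡0⇒p≡⊥ []ᵛ _ = refl
∣p∣≡0⇒p≡⊥ (outside ∷ᵛ p) eq = cong (outside ∷ᵛ_) (∣p∣≡0⇒p≡⊥ p eq)

∣p∣≡1⇒p≡⁅x⁆ : ∀ (p : Subset n) → ∣ p ∣ ≡ 1 → ∃ λ x → p ≡ ⁅ x ⁆
∣p∣≡1⇒p≡⁅x⁆ (inside ∷ᵛ p) eq = 0F , cong (inside ∷ᵛ_) (∣p∣≡0⇒p≡⊥ p (suc-injective eq))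
∣p∣≡1⇒p≡⁅x⁆ (outside ∷ᵛ p) eq with ∣p∣≡1⇒p≡⁅x⁆ p eq
... | x , refl = sucF x , refl

∣p∣≡2⇒p≡⁅x⁆∪⁅y⁆ : ∀ (p : Subset n) → ∣ p ∣ ≡ 2 → ∃₂ λ x y → x ≢ y × p ≡ ⁅ x ⁆ ∪ ⁅ y ⁆
∣p∣≡2⇒p≡⁅x⁆∪⁅y⁆ (inside ∷ᵛ p) eq with ∣p∣≡1⇒p≡⁅x⁆ p (suc-injective eq)
... | y , refl = 0F , sucF y , (λ ()) , cong (inside ∷ᵛ_) (sym (∪-identityˡ ⁅ y ⁆))
∣p∣≡2⇒p≡⁅x⁆∪⁅y⁆ (outside ∷ᵛ p) eq with ∣p∣≡2⇒p≡⁅x⁆∪⁅y⁆ p eq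
... | x , y , x≢y , refl = sucF x , sucF y , (λ { refl → x≢y refl }) , refl

∣p∣≡m⇒∁p≡⁅x⁆∪⁅y⁆ : ∀ {m} (p : Subset (2 + m)) → ∣ p ∣ ≡ m → ∃₂ λ x y → x ≢ y × ∁ p ≡ ⁅ x ⁆ ∪ ⁅ y ⁆
∣p∣≡m⇒∁p≡⁅x⁆∪⁅y⁆ {m} p ∣p∣≡m =
  ∣p∣≡2⇒p≡⁅x⁆∪⁅y⁆ (∁ p) (trans (∣∁p∣≡n∸∣p∣ p) (trans (cong (2 + m ∸_) ∣p∣≡m) (m+n∸n≡m 2 m)))

MissDisjointPairs : Subset n → Subset n → Set
MissDisjointPairs S T = ∃₂ λ x y → ∃₂ λ u w →
  ∁ S ≡ ⁅ x ⁆ ∪ ⁅ y ⁆ × ∁ T ≡ ⁅ u ⁆ ∪ ⁅ w ⁆ × Unique (x ∷ y ∷ u ∷ w ∷ [])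

head-∈ : ∀ {A : Set} {xs : List A} {x} → head xs ≡ just x → x ∈ xs
head-∈ {xs = y ∷ xs} refl = here refl

last-∈ : ∀ {A : Set} {xs : List A} {x} → last xs ≡ just x → x ∈ xs
last-∈ {xs = y ∷ []} refl = here refl
last-∈ {xs = y ∷ z ∷ xs} eq = there (last-∈ {xs = z ∷ xs} eq)

avoid-two : (a b : Fin 3) → ∃ λ c → c ≢ a × c ≢ b
avoid-two = from-yes decision
  where
  decision : Dec ((a b : Fin 3) → ∃ λ c → c ≢ a × c ≢ b)
  decision = all? λ a → all? λ b → any? λ c → ¬? (c ≟ᶠ a) ×-dec ¬? (c ≟ᶠ b)

other-of-three : (a b c e : Fin 3) → a ≢ b → a ≢ c → b ≢ c → e ≢ a → e ≡ b ⊎ e ≡ c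
other-of-three = from-yes decision
  where
  decision : Dec ((a b c e : Fin 3) → a ≢ b → a ≢ c → b ≢ c → e ≢ a → e ≡ b ⊎ e ≡ c)
  decision = all? λ a → all? λ b → all? λ c → all? λ e →
    ¬? (a ≟ᶠ b) →-dec ¬? (a ≟ᶠ c) →-dec ¬? (b ≟ᶠ c) →-dec ¬? (e ≟ᶠ a) →-dec ((e ≟ᶠ b) ⊎-dec (e ≟ᶠ c))

transpose-matchˡ : ∀ (i j : Fin n) → PC.transpose i j i ≡ j
transpose-matchˡ i j with i ≟ᶠ i
... | yes _ = refl
... | no i≢i = ⊥-elim (i≢i refl)

transpose-other : ∀ {i j k : Fin n} → k ≢ i → k ≢ j → PC.transpose i j k ≡ k
transpose-other {i = i} {j} {k} k≢i k≢j with k ≟ᶠ i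
... | yes k≡i = ⊥-elim (k≢i k≡i)
... | no _ with k ≟ᶠ j
...   | yes k≡j = ⊥-elim (k≢j k≡j)
...   | no _ = refl

∃-permutation-matching : ∀ (ℓs vs : List (Fin n)) → Unique ℓs → Unique vs → length ℓs ≡ length vs →
          ∃ λ (π : Permutation′ n) → Pointwise (λ ℓ v → π ⟨$⟩ʳ ℓ ≡ v) ℓs vs
∃-permutation-matching [] [] _ _ _ = idₚ , []
∃-permutation-matching (ℓ ∷ ℓs) (v ∷ vs) (ℓ≢ℓs ∷ ℓs-unique) (v≢vs ∷ vs-unique) eq
  with π , π-∃-permutation-matchings ← ∃-permutation-matching ℓs vs ℓs-unique vs-unique (suc-injective eq)
  = π′ , π′-hit ∷ keep ℓ≢ℓs v≢vs π-∃-permutation-matchings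
  where
  π′ : Permutation′ _
  π′ = transpose ℓ (π ⟨$⟩ˡ v) ∘ₚ π
  π′-hit : π′ ⟨$⟩ʳ ℓ ≡ v
  π′-hit = trans (cong (π ⟨$⟩ʳ_) (transpose-matchˡ ℓ _)) (inverseʳ π)
  keep : ∀ {ℓs vs} → All (ℓ ≢_) ℓs → All (v ≢_) vs →
         Pointwise (λ ℓ′ v′ → π ⟨$⟩ʳ ℓ′ ≡ v′) ℓs vs → Pointwise (λ ℓ′ v′ → π′ ⟨$⟩ʳ ℓ′ ≡ v′) ℓs vs
  keep [] [] [] = []
  keep (ℓ≢ℓ′ ∷ ℓ≢) (v≢v′ ∷ v≢) (πℓ′≡v′ ∷ rest) =
    trans (cong (π ⟨$⟩ʳ_) (transpose-other (≢-sym ℓ≢ℓ′) ℓ′≢π⁻¹v)) πℓ′≡v′ ∷ keep ℓ≢ v≢ rest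
    where
    ℓ′≢π⁻¹v : _ ≢ π ⟨$⟩ˡ v
    ℓ′≢π⁻¹v ℓ′≡ = v≢v′ (trans (sym (inverseʳ π)) (trans (cong (π ⟨$⟩ʳ_) (sym ℓ′≡)) πℓ′≡v′))

module Cyclic (n : ℕ) .{{_ : NonZero n}} where

  ⟦_⟧ : ℕ → Fin n
  ⟦ m ⟧ = m mod n

  toℕ-⟦⟧ : ∀ m → toℕ ⟦ m ⟧ ≡ m % n
  toℕ-⟦⟧ m = toℕ-fromℕ< (m%n<n m n)

  toℕ-⟦⟧-< : ∀ {m} → m < n → toℕ ⟦ m ⟧ ≡ m
  toℕ-⟦⟧-< {m} m<n = trans (toℕ-⟦⟧ m) (m<n⇒m%n≡m m<n)

  ⟦toℕ⟧ : ∀ ℓ → ⟦ toℕ ℓ ⟧ ≡ ℓ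
  ⟦toℕ⟧ ℓ = toℕ-injective (toℕ-⟦⟧-< (toℕ<n ℓ))

  ⟦⟧-cong-% : ∀ {m m′} → m % n ≡ m′ % n → ⟦ m ⟧ ≡ ⟦ m′ ⟧
  ⟦⟧-cong-% {m} {m′} eq = toℕ-injective (trans (toℕ-⟦⟧ m) (trans eq (sym (toℕ-⟦⟧ m′))))

  [m%n+k]%n≡[m+k]%n : ∀ m k → (m % n + k) % n ≡ (m + k) % n
  [m%n+k]%n≡[m+k]%n m k = begin
    (m % n + k) % n          ≡⟨ %-distribˡ-+ (m % n) k n ⟩
    (m % n % n + k % n) % n  ≡⟨ cong (λ r → (r + k % n) % n) (m%n%n≡m%n m n) ⟩
    (m % n + k % n) % n      ≡⟨ %-distribˡ-+ m k n ⟨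
    (m + k) % n              ∎
    where open ≡-Reasoning

  ⟦+⟧-surjective : ∀ i ℓ → ∃ λ k → k < n × ⟦ i + k ⟧ ≡ ℓ
  ⟦+⟧-surjective i ℓ = k % n , m%n<n k n , trans (⟦⟧-cong-% (begin
    (i + k % n) % n      ≡⟨ [m%n+k]%n≡[m+k]%n i (k % n) ⟨
    (r + k % n) % n      ≡⟨ cong (_% n) (+-comm r (k % n)) ⟩
    (k % n + r) % n      ≡⟨ [m%n+k]%n≡[m+k]%n k r ⟩
    (k + r) % n          ≡⟨ cong (_% n) (m∸n+n≡m r≤ℓ+n) ⟩
    (toℕ ℓ + n) % n      ≡⟨ [m+n]%n≡m%n (toℕ ℓ) n ⟩
    toℕ ℓ % n            ∎)) (⟦toℕ⟧ ℓ)
    where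
    open ≡-Reasoning
    r = i % n
    k = toℕ ℓ + n ∸ r
    r≤ℓ+n : r ≤ toℕ ℓ + n
    r≤ℓ+n = ≤-trans (<⇒≤ (m%n<n i n)) (m≤n+m n (toℕ ℓ))

  next : Fin n → Fin n
  next ℓ = ⟦ suc (toℕ ℓ) ⟧

  ⟦suc⟧ : ∀ m → ⟦ suc m ⟧ ≡ next ⟦ m ⟧
  ⟦suc⟧ m = ⟦⟧-cong-% (begin
    suc m % n             ≡⟨ cong (_% n) (+-comm 1 m) ⟩
    (m + 1) % n           ≡⟨ [m%n+k]%n≡[m+k]%n m 1 ⟨
    (m % n + 1) % n       ≡⟨ cong (λ r → (r + 1) % n) (toℕ-⟦⟧ m) ⟨
    (toℕ ⟦ m ⟧ + 1) % n   ≡⟨ cong (_% n) (+-comm (toℕ ⟦ m ⟧) 1) ⟩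
    suc (toℕ ⟦ m ⟧) % n   ∎)
    where open ≡-Reasoning

  ⟦+suc⟧ : ∀ i m → ⟦ i + suc m ⟧ ≡ next (⟦ i + m ⟧)
  ⟦+suc⟧ i m = trans (cong ⟦_⟧ (+-suc i m)) (⟦suc⟧ (i + m))

  prev : Fin n → Fin n
  prev ℓ = ⟦ toℕ ℓ + (n ∸ 1) ⟧

  prev-next : ∀ ℓ → prev (next ℓ) ≡ ℓ
  prev-next ℓ = trans (⟦⟧-cong-% (begin
    (toℕ ⟦ suc x ⟧ + (n ∸ 1)) % n   ≡⟨ cong (λ r → (r + (n ∸ 1)) % n) (toℕ-⟦⟧ (suc x)) ⟩
    (suc x % n + (n ∸ 1)) % n       ≡⟨ [m%n+k]%n≡[m+k]%n (suc x) (n ∸ 1) ⟩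
    (suc x + (n ∸ 1)) % n           ≡⟨ cong (_% n) (+-suc x (n ∸ 1)) ⟨
    (x + suc (n ∸ 1)) % n           ≡⟨ cong (λ m → (x + m) % n) (suc-pred n) ⟩
    (x + n) % n                     ≡⟨ [m+n]%n≡m%n x n ⟩
    x % n                           ∎)) (⟦toℕ⟧ ℓ)
    where
    open ≡-Reasoning
    x = toℕ ℓ

  next-injective : ∀ {a b} → next a ≡ next b → a ≡ b
  next-injective {a} {b} eq = trans (sym (prev-next a)) (trans (cong prev eq) (prev-next b))

  ⟦suc+⟧≢ : ∀ {k} → suc k < n → ∀ ℓ → ⟦ suc k + toℕ ℓ ⟧ ≢ ℓ
  ⟦suc+⟧≢ {k} 1+k<n ℓ eq with suc k + toℕ ℓ <? n
  ... | yes k+x<n =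
    m+1+n≢m (toℕ ℓ) (trans (+-comm (toℕ ℓ) (suc k)) (trans (sym (toℕ-⟦⟧-< k+x<n)) (cong toℕ eq)))
  ... | no k+x≮n = <-irrefl (+-cancelˡ-≡ x (suc k) n x+k≡x+n) 1+k<n
    where
    x = toℕ ℓ
    n≤k+x : n ≤ suc k + x
    n≤k+x = ≮⇒≥ k+x≮n
    wrapped<n : suc k + x ∸ n < n
    wrapped<n = +-cancelʳ-< _ _ n (subst (_< n + n) (sym (m∸n+n≡m n≤k+x)) (+-mono-≤-< (<⇒≤ 1+k<n) (toℕ<n ℓ)))
    wrapped≡x : suc k + x ∸ n ≡ x
    wrapped≡x = begin
      suc k + x ∸ n         ≡⟨ m<n⇒m%n≡m wrapped<n ⟨
      (suc k + x ∸ n) % n   ≡⟨ m≤n⇒[n∸m]%m≡n%m n≤k+x ⟩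
      (suc k + x) % n       ≡⟨ toℕ-⟦⟧ (suc k + x) ⟨
      toℕ ⟦ suc k + x ⟧     ≡⟨ cong toℕ eq ⟩
      x                     ∎
      where open ≡-Reasoning
    x+k≡x+n : x + suc k ≡ x + n
    x+k≡x+n = trans (+-comm x (suc k)) (trans (sym (m∸n+n≡m n≤k+x)) (cong (_+ n) wrapped≡x))

  Adjacent : Fin n → Fin n → Set
  Adjacent a b = b ≡ next a ⊎ a ≡ next b

  no-adjacent-triangle : 3 < n → ∀ {a b c} → a ≢ b → a ≢ c → b ≢ c →
                         Adjacent a b → Adjacent b c → Adjacent a c → Empty
  no-adjacent-triangle 3<n {a} {b} {c} a≢b a≢c b≢c = go
    where
    next³≢id : ∀ ℓ → next (next (next ℓ)) ≢ ℓ
    next³≢id ℓ eq = ⟦suc+⟧≢ 3<n ℓ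
      (trans (⟦suc⟧ (2 + toℕ ℓ)) (trans (cong next (⟦suc⟧ (suc (toℕ ℓ)))) eq))
    go : Adjacent a b → Adjacent b c → Adjacent a c → Empty
    go (inj₁ b≡a⁺) (inj₁ c≡b⁺) (inj₁ c≡a⁺) = b≢c (trans b≡a⁺ (sym c≡a⁺))
    go (inj₁ b≡a⁺) (inj₁ c≡b⁺) (inj₂ a≡c⁺) = next³≢id a (sym (trans a≡c⁺ (cong next (trans c≡b⁺ (cong next b≡a⁺)))))
    go (inj₁ b≡a⁺) (inj₂ b≡c⁺) _           = a≢c (next-injective (trans (sym b≡a⁺) b≡c⁺))
    go (inj₂ a≡b⁺) (inj₁ c≡b⁺) _           = a≢c (trans a≡b⁺ (sym c≡b⁺))
    go (inj₂ a≡b⁺) (inj₂ b≡c⁺) (inj₁ c≡a⁺) = next³≢id c (sym (trans c≡a⁺ (cong next (trans a≡b⁺ (cong next b≡c⁺)))))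
    go (inj₂ a≡b⁺) (inj₂ b≡c⁺) (inj₂ a≡c⁺) = b≢c (next-injective (trans (sym a≡b⁺) a≡c⁺))

  labeling-injective : ∀ (π : Labeling n) {a b} → π ⟨$⟩ʳ a ≡ π ⟨$⟩ʳ b → a ≡ b
  labeling-injective π {a} {b} eq = trans (sym (inverseˡ π)) (trans (cong (π ⟨$⟩ˡ_) eq) (inverseˡ π))

  ∈-window⁺ : ∀ d (π : Labeling n) i {k} → k ≤ d → π ⟨$⟩ʳ ⟦ i + k ⟧ ∈ₛ H d π i
  ∈-window⁺ d π i k≤d = ∈⋃⁺ _ (∈-map⁺ _ (∈-upTo⁺ (s≤s k≤d))) (x∈⁅x⁆ _)

  ∈-window⁻ : ∀ d (π : Labeling n) i {ℓ} → π ⟨$⟩ʳ ℓ ∈ₛ H d π i → ∃ λ k → k ≤ d × ⟦ i + k ⟧ ≡ ℓ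
  ∈-window⁻ d π i πℓ∈
    with s , s∈ , πℓ∈s ← ∈⋃⁻ _ πℓ∈
    with k , k∈ , refl ← ∈-map⁻ (λ k → ⁅ π ⟨$⟩ʳ ⟦ i + k ⟧ ⁆) s∈
    = k , s≤s⁻¹ (∈-upTo⁻ k∈) , sym (labeling-injective π (x∈⁅y⁆⇒x≡y _ πℓ∈s))

  ∈-unwrapped-window⁺ : ∀ d (π : Labeling n) {i ℓ} → i ≤ toℕ ℓ → toℕ ℓ ≤ i + d → π ⟨$⟩ʳ ℓ ∈ₛ H d π i
  ∈-unwrapped-window⁺ d π {i} {ℓ} i≤ℓ ℓ≤i+d =
    subst (λ ℓ′ → π ⟨$⟩ʳ ℓ′ ∈ₛ H d π i) (trans (cong ⟦_⟧ (m+[n∸m]≡n i≤ℓ)) (⟦toℕ⟧ ℓ))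
      (∈-window⁺ d π i (m≤n+o⇒m∸n≤o (toℕ ℓ) i ℓ≤i+d))

  ∈-unwrapped-window⁻ : ∀ d (π : Labeling n) {i ℓ} → i + d < n → π ⟨$⟩ʳ ℓ ∈ₛ H d π i → i ≤ toℕ ℓ × toℕ ℓ ≤ i + d
  ∈-unwrapped-window⁻ d π {i} i+d<n πℓ∈ with k , k≤d , refl ← ∈-window⁻ d π i πℓ∈
    rewrite toℕ-⟦⟧-< (≤-<-trans (+-monoʳ-≤ i k≤d) i+d<n) = m≤m+n i k , +-monoʳ-≤ i k≤d

module _ (d : ℕ) where
  open Cyclic (3 + d)

  window-gap : ∀ (π : Labeling (3 + d)) i {ℓ} → π ⟨$⟩ʳ ℓ ∉ₛ H d π i →
               ℓ ≡ ⟦ i + suc d ⟧ ⊎ ℓ ≡ ⟦ i + suc (suc d) ⟧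
  window-gap π i {ℓ} πℓ∉ with k , k<n , refl ← ⟦+⟧-surjective i ℓ with k ≤? d
  ... | yes k≤d = ⊥-elim (πℓ∉ (∈-window⁺ d π i k≤d))
  ... | no k≰d with m≤n⇒m<n∨m≡n (s≤s⁻¹ k<n)
  ...   | inj₁ k<2+d = inj₁ (cong (λ j → ⟦ i + j ⟧) (≤-antisym (s≤s⁻¹ k<2+d) (≰⇒> k≰d)))
  ...   | inj₂ k≡2+d = inj₂ (cong (λ j → ⟦ i + j ⟧) k≡2+d)

  window-gap-adjacent : ∀ (π : Labeling (3 + d)) i {a b} →
                        π ⟨$⟩ʳ a ∉ₛ H d π i → π ⟨$⟩ʳ b ∉ₛ H d π i → a ≢ b → Adjacent a b
  window-gap-adjacent π i a∉ b∉ a≢b with window-gap π i a∉ | window-gap π i b∉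
  ... | inj₁ refl | inj₁ refl = ⊥-elim (a≢b refl)
  ... | inj₂ refl | inj₂ refl = ⊥-elim (a≢b refl)
  ... | inj₁ refl | inj₂ refl = inj₁ (⟦+suc⟧ i (suc d))
  ... | inj₂ refl | inj₁ refl = inj₂ (⟦+suc⟧ i (suc d))

  windows-0-2-cover : 1 ≤ d → ∀ (π : Labeling (3 + d)) v → v ∈ₛ H d π 0 ⊎ v ∈ₛ H d π 2
  windows-0-2-cover 1≤d π v with toℕ (π ⟨$⟩ˡ v) ≤? d
  ... | yes ℓ≤d = inj₁ (subst (_∈ₛ H d π 0) (inverseʳ π) (∈-unwrapped-window⁺ d π z≤n ℓ≤d))
  ... | no ℓ≰d = inj₂ (subst (_∈ₛ H d π 2) (inverseʳ π)
                   (∈-unwrapped-window⁺ d π (≤-trans (s≤s 1≤d) (≰⇒> ℓ≰d)) (s≤s⁻¹ (toℕ<n (π ⟨$⟩ˡ v)))))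

  window-gap-vertices : ∀ (π : Labeling (3 + d)) i {v} → v ∉ₛ H d π i →
                        v ≡ π ⟨$⟩ʳ ⟦ i + suc d ⟧ ⊎ v ≡ π ⟨$⟩ʳ ⟦ i + suc (suc d) ⟧
  window-gap-vertices π i {v} v∉ with window-gap π i (subst (_∉ₛ H d π i) (sym (inverseʳ π)) v∉)
  ... | inj₁ eq = inj₁ (trans (sym (inverseʳ π)) (cong (π ⟨$⟩ʳ_) eq))
  ... | inj₂ eq = inj₂ (trans (sym (inverseʳ π)) (cong (π ⟨$⟩ʳ_) eq))

  ∁-window-0 : ∀ (π : Labeling (3 + d)) → ∁ (H d π 0) ≡ ⁅ π ⟨$⟩ʳ ⟦ 1 + d ⟧ ⁆ ∪ ⁅ π ⟨$⟩ʳ ⟦ 2 + d ⟧ ⁆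
  ∁-window-0 π = ∁≡⁅x⁆∪⁅y⁆ (beyond (n≤1+n _) ≤-refl) (beyond ≤-refl (n≤1+n _)) (λ _ → window-gap-vertices π 0)
    where
    beyond : ∀ {m} → m < 3 + d → d < m → π ⟨$⟩ʳ ⟦ m ⟧ ∉ₛ H d π 0
    beyond m<n d<m ∈H =
      <⇒≱ d<m (subst (_≤ d) (toℕ-⟦⟧-< m<n) (proj₂ (∈-unwrapped-window⁻ d π (m<n+m d (s≤s z≤n)) ∈H)))

  ∁-window-2 : ∀ (π : Labeling (3 + d)) → ∁ (H d π 2) ≡ ⁅ π ⟨$⟩ʳ ⟦ 0 ⟧ ⁆ ∪ ⁅ π ⟨$⟩ʳ ⟦ 1 ⟧ ⁆
  ∁-window-2 π = ∁≡⁅x⁆∪⁅y⁆ (before (s≤s z≤n) (s≤s z≤n)) (before (s≤s (s≤s z≤n)) (s≤s (s≤s z≤n))) only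
    where
    before : ∀ {m} → m < 3 + d → m < 2 → π ⟨$⟩ʳ ⟦ m ⟧ ∉ₛ H d π 2
    before m<n m<2 ∈H =
      <⇒≱ m<2 (subst (2 ≤_) (toℕ-⟦⟧-< m<n) (proj₁ (∈-unwrapped-window⁻ d π ≤-refl ∈H)))
    only : ∀ v → v ∉ₛ H d π 2 → v ≡ π ⟨$⟩ʳ ⟦ 0 ⟧ ⊎ v ≡ π ⟨$⟩ʳ ⟦ 1 ⟧
    only v v∉ with window-gap-vertices π 2 v∉
    ... | inj₁ eq = inj₁ (trans eq (cong (π ⟨$⟩ʳ_) (⟦⟧-cong-% {3 + d} {0} (n%n≡0 (3 + d)))))
    ... | inj₂ eq = inj₂ (trans eq (cong (π ⟨$⟩ʳ_) (⟦⟧-cong-% {4 + d} {1} ([m+n]%n≡m%n 1 (3 + d)))))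

  apex : Fin 3 → Fin (3 + d)
  apex a = vtx d (toℕ a)

  facet : Fin 3 → Subset (3 + d)
  facet a = base d ∪ ⁅ apex a ⁆

  toℕ-apex : ∀ a → toℕ (apex a) ≡ d + toℕ a
  toℕ-apex a = toℕ-⟦⟧-< (subst (d + toℕ a <_) (+-comm d 3) (+-monoʳ-< d (toℕ<n a)))

  apex-injective : ∀ {a b} → apex a ≡ apex b → a ≡ b
  apex-injective {a} {b} eq =
    toℕ-injective (+-cancelˡ-≡ d _ _ (trans (sym (toℕ-apex a)) (trans (cong toℕ eq) (toℕ-apex b))))

  ∈-base⁻ : ∀ {v} → v ∈ₛ base d → toℕ v < d
  ∈-base⁻ {v} v∈ =
    <ᵇ⇒< (toℕ v) d (Equivalence.from T-≡ (trans (sym (lookup∘tabulate (λ u → toℕ u <ᵇ d) v)) ([]=⇒lookup v∈)))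

  ∈-base⁺ : ∀ {v} → toℕ v < d → v ∈ₛ base d
  ∈-base⁺ {v} v<d =
    lookup⇒[]= v (base d) (trans (lookup∘tabulate (λ u → toℕ u <ᵇ d) v) (Equivalence.to T-≡ (<⇒<ᵇ v<d)))

  apex∉base : ∀ a → apex a ∉ₛ base d
  apex∉base a ∈H = <⇒≱ (∈-base⁻ ∈H) (subst (d ≤_) (sym (toℕ-apex a)) (m≤m+n d (toℕ a)))

  base-or-apex : ∀ v → v ∈ₛ base d ⊎ ∃ λ a → v ≡ apex a
  base-or-apex v with toℕ v <? d
  ... | yes v<d = inj₁ (∈-base⁺ v<d)
  ... | no v≮d = inj₂ (a , toℕ-injective (begin
      toℕ v               ≡⟨ m+[n∸m]≡n d≤v ⟨
      d + (toℕ v ∸ d)     ≡⟨ cong (d +_) (toℕ-fromℕ< v∸d<3) ⟨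
      d + toℕ a           ≡⟨ toℕ-apex a ⟨
      toℕ (apex a)        ∎))
    where
    open ≡-Reasoning
    d≤v = ≮⇒≥ v≮d
    v∸d<3 : toℕ v ∸ d < 3
    v∸d<3 = m<n+o⇒m∸n<o (toℕ v) d (subst (toℕ v <_) (+-comm 3 d) (toℕ<n v))
    a = fromℕ< v∸d<3

  ∈-facet⁻ : ∀ {a v} → v ∈ₛ facet a → v ∈ₛ base d ⊎ v ≡ apex a
  ∈-facet⁻ {a} v∈ with x∈p∪q⁻ (base d) ⁅ apex a ⁆ v∈
  ... | inj₁ v∈base = inj₁ v∈base
  ... | inj₂ v∈apex = inj₂ (x∈⁅y⁆⇒x≡y _ v∈apex)

  apex∈facet⇒≡ : ∀ {a b} → apex b ∈ₛ facet a → b ≡ a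
  apex∈facet⇒≡ {a} {b} ∈facet with ∈-facet⁻ ∈facet
  ... | inj₁ ∈base = ⊥-elim (apex∉base b ∈base)
  ... | inj₂ eq = apex-injective eq

  apex∈facet : ∀ a → apex a ∈ₛ facet a
  apex∈facet a = x∈p∪q⁺ (inj₂ (x∈⁅x⁆ (apex a)))

  ∁-facet : ∀ {a b c} → a ≢ b → a ≢ c → b ≢ c → ∁ (facet a) ≡ ⁅ apex b ⁆ ∪ ⁅ apex c ⁆
  ∁-facet {a} {b} {c} a≢b a≢c b≢c = ∁≡⁅x⁆∪⁅y⁆ (a≢b ∘ sym ∘ apex∈facet⇒≡) (a≢c ∘ sym ∘ apex∈facet⇒≡) only
    where
    only : ∀ v → v ∉ₛ facet a → v ≡ apex b ⊎ v ≡ apex c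
    only v v∉ with base-or-apex v
    ... | inj₁ v∈base = ⊥-elim (v∉ (x∈p∪q⁺ (inj₁ v∈base)))
    ... | inj₂ (e , refl) with other-of-three a b c e a≢b a≢c b≢c (λ { refl → v∉ (apex∈facet a) })
    ...   | inj₁ refl = inj₁ refl
    ...   | inj₂ refl = inj₂ refl

  ∈W⇒facet : ∀ {X} → X ∈ W d → ∃ λ a → X ≡ facet a
  ∈W⇒facet (here refl) = 0F , refl
  ∈W⇒facet (there (here refl)) = 1F , refl
  ∈W⇒facet (there (there (here refl))) = 2F , refl

  facet∈W : ∀ a → facet a ∈ W d
  facet∈W 0F = here refl
  facet∈W 1F = there (here refl)
  facet∈W 2F = there (there (here refl))

  windows-0-2-not-both-in-W : 1 ≤ d → ∀ (π : Labeling (3 + d)) → H d π 0 ∈ W d → H d π 2 ∈ W d → Empty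
  windows-0-2-not-both-in-W 1≤d π H₀∈W H₂∈W
    with a , H₀≡ ← ∈W⇒facet H₀∈W
    with b , H₂≡ ← ∈W⇒facet H₂∈W
    with c , c≢a , c≢b ← avoid-two a b
    with windows-0-2-cover 1≤d π (apex c)
  ... | inj₁ c∈H₀ = c≢a (apex∈facet⇒≡ (subst (apex c ∈ₛ_) H₀≡ c∈H₀))
  ... | inj₂ c∈H₂ = c≢b (apex∈facet⇒≡ (subst (apex c ∈ₛ_) H₂≡ c∈H₂))

  no-weak-path : 1 ≤ d → ¬ WeakHamPath d (W d)
  no-weak-path 1≤d P =
    windows-0-2-not-both-in-W 1≤d lab (lookupᴬ facets (head-∈ first)) (lookupᴬ facets (last-∈ (trans final last≡2)))
    where
    open WeakHamPath P
    last≡2 : just (3 + d ∸ d ∸ 1) ≡ just 2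
    last≡2 = cong (λ m → just (m ∸ 1)) (m+n∸n≡m 3 d)

  facet-is-a-window : ∀ (C : WeakHamCycle d (W d)) a → ∃ λ i → H d (WeakHamCycle.lab C) i ≡ facet a
  facet-is-a-window record { lab = π ; indices = is ; facets = facets ; covers = covers } a
    with s , s∈ , apex∈s ← ∈⋃⁻ (map (H d π) is) (subst (apex a ∈ₛ_) (sym covers) ∈⊤)
    with i , i∈ , refl ← ∈-map⁻ (H d π) s∈
    with c , Hᵢ≡ ← ∈W⇒facet (lookupᴬ facets i∈)
    rewrite apex∈facet⇒≡ (subst (apex a ∈ₛ_) Hᵢ≡ apex∈s) = i , Hᵢ≡

  no-weak-cycle : 1 ≤ d → ¬ WeakHamCycle d (W d)
  no-weak-cycle 1≤d C =
    no-adjacent-triangle (+-monoʳ-≤ 3 1≤d) (label-≢ 0F 1F (λ ())) (label-≢ 0F 2F (λ ())) (label-≢ 1F 2F (λ ()))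
      (others-adjacent 2F 0F 1F (λ ()) (λ ()) (λ ()))
      (others-adjacent 0F 1F 2F (λ ()) (λ ()) (λ ()))
      (others-adjacent 1F 0F 2F (λ ()) (λ ()) (λ ()))
    where
    open WeakHamCycle C
    label : Fin 3 → Fin (3 + d)
    label a = lab ⟨$⟩ˡ apex a
    label-≢ : ∀ a b → a ≢ b → label a ≢ label b
    label-≢ _ _ a≢b eq = a≢b (apex-injective (trans (sym (inverseʳ lab)) (trans (cong (lab ⟨$⟩ʳ_) eq) (inverseʳ lab))))
    others-adjacent : ∀ a b c → b ≢ a → c ≢ a → b ≢ c → Adjacent (label b) (label c)
    others-adjacent a b c b≢a c≢a b≢c with i , Hᵢ≡ ← facet-is-a-window C a =
      window-gap-adjacent lab i (missed b≢a) (missed c≢a) (label-≢ b c b≢c)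
      where
      missed : ∀ {e} → e ≢ a → lab ⟨$⟩ʳ label e ∉ₛ H d lab i
      missed e≢a ∈H = e≢a (apex∈facet⇒≡ (subst (_ ∈ₛ_) Hᵢ≡ (subst (_∈ₛ H d lab i) (inverseʳ lab) ∈H)))

  gap-labels-unique : 1 ≤ d → Unique (⟦ 1 + d ⟧ ∷ ⟦ 2 + d ⟧ ∷ ⟦ 0 ⟧ ∷ ⟦ 1 ⟧ ∷ [])
  gap-labels-unique 1≤d =
      (⟦⟧-≢ 1+d<n ≤-refl (1+n≢n ∘ sym) ∷ ⟦⟧-≢ 1+d<n 0<n (λ ()) ∷ ⟦⟧-≢ 1+d<n 1<n (<⇒≢ 1≤d ∘ sym ∘ suc-injective) ∷ [])
    ∷ (⟦⟧-≢ ≤-refl 0<n (λ ()) ∷ ⟦⟧-≢ ≤-refl 1<n (λ ()) ∷ [])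
    ∷ (⟦⟧-≢ 0<n 1<n (λ ()) ∷ [])
    ∷ [] ∷ []
    where
    ⟦⟧-≢ : ∀ {m m′} → m < 3 + d → m′ < 3 + d → m ≢ m′ → ⟦ m ⟧ ≢ ⟦ m′ ⟧
    ⟦⟧-≢ m<n m′<n m≢m′ eq = m≢m′ (trans (sym (toℕ-⟦⟧-< m<n)) (trans (cong toℕ eq) (toℕ-⟦⟧-< m′<n)))
    0<n : 0 < 3 + d
    0<n = s≤s z≤n
    1<n : 1 < 3 + d
    1<n = s≤s (s≤s z≤n)
    1+d<n : 1 + d < 3 + d
    1+d<n = n≤1+n _

  labeling-with-gaps : 1 ≤ d → ∀ {x y u w} → Unique (x ∷ y ∷ u ∷ w ∷ []) → ∃ λ (π : Labeling (3 + d)) →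
                       π ⟨$⟩ʳ ⟦ 1 + d ⟧ ≡ x × π ⟨$⟩ʳ ⟦ 2 + d ⟧ ≡ y × π ⟨$⟩ʳ ⟦ 0 ⟧ ≡ u × π ⟨$⟩ʳ ⟦ 1 ⟧ ≡ w
  labeling-with-gaps 1≤d {x} {y} {u} {w} vertices-unique
    with π , πx ∷ πy ∷ πu ∷ πw ∷ [] ←
           ∃-permutation-matching _ (x ∷ y ∷ u ∷ w ∷ []) (gap-labels-unique 1≤d) vertices-unique refl
    = π , πx , πy , πu , πw

  two-windows-cycle : 2 ≤ d → ∀ {Δ S T} → S ∈ Δ → T ∈ Δ → MissDisjointPairs S T → WeakHamCycle d Δ
  two-windows-cycle 2≤d {Δ} {S} {T} S∈Δ T∈Δ (x , y , u , w , ∁S≡ , ∁T≡ , vertices-unique)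
    with π , πx , πy , πu , πw ← labeling-with-gaps (≤-trans (s≤s z≤n) 2≤d) vertices-unique
    = record
    { lab        = π
    ; indices    = 0 ∷ 2 ∷ []
    ; bounded    = s≤s z≤n ∷ s≤s (s≤s (s≤s z≤n)) ∷ []
    ; increasing = s≤s z≤n ∷ [-]
    ; facets     = subst (_∈ Δ) (sym H₀≡S) S∈Δ ∷ subst (_∈ Δ) (sym H₂≡T) T∈Δ ∷ []
    ; covers     = ⊆-antisym ⊆⊤ (λ {v} _ → covered v)
    ; overlaps   = (π ⟨$⟩ʳ ⟦ 2 ⟧ , x∈p∩q⁺ (shared∈H₀ , shared∈H₂)) ∷ [-]
    ; closes     = λ { _ _ refl refl → π ⟨$⟩ʳ ⟦ 2 ⟧ , x∈p∩q⁺ (shared∈H₂ , shared∈H₀) }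
    }
    where
    1≤d : 1 ≤ d
    1≤d = ≤-trans (s≤s z≤n) 2≤d
    H₀≡S : H d π 0 ≡ S
    H₀≡S = ∁-injective (trans (∁-window-0 π) (trans (cong₂ (λ a b → ⁅ a ⁆ ∪ ⁅ b ⁆) πx πy) (sym ∁S≡)))
    H₂≡T : H d π 2 ≡ T
    H₂≡T = ∁-injective (trans (∁-window-2 π) (trans (cong₂ (λ a b → ⁅ a ⁆ ∪ ⁅ b ⁆) πu πw) (sym ∁T≡)))
    covered : ∀ v → v ∈ₛ ⋃ (map (H d π) (0 ∷ 2 ∷ []))
    covered v with windows-0-2-cover 1≤d π v
    ... | inj₁ v∈H₀ = ∈⋃⁺ (map (H d π) (0 ∷ 2 ∷ [])) (here refl) v∈H₀
    ... | inj₂ v∈H₂ = ∈⋃⁺ (map (H d π) (0 ∷ 2 ∷ [])) (there (here refl)) v∈H₂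
    shared∈H₀ : π ⟨$⟩ʳ ⟦ 2 ⟧ ∈ₛ H d π 0
    shared∈H₀ = ∈-window⁺ d π 0 2≤d
    shared∈H₂ : π ⟨$⟩ʳ ⟦ 2 ⟧ ∈ₛ H d π 2
    shared∈H₂ = ∈-window⁺ d π 2 z≤n

  base≢apex : ∀ {v} a → v ∈ₛ base d → v ≢ apex a
  base≢apex a v∈base refl = apex∉base a v∈base

  apex-≢ : ∀ {a b} → a ≢ b → apex a ≢ apex b
  apex-≢ a≢b = a≢b ∘ apex-injective

  partner-facet-of-base-gap : ∀ {F x y} → x ∈ₛ base d → x ≢ y → ∁ F ≡ ⁅ x ⁆ ∪ ⁅ y ⁆ →
                              ∃ λ a → MissDisjointPairs F (facet a)
  partner-facet-of-base-gap {F} {x} {y} x∈base x≢y ∁F≡ with base-or-apex y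
  ... | inj₁ y∈base = 0F , x , y , apex 1F , apex 2F , ∁F≡ , ∁-facet (λ ()) (λ ()) (λ ()) ,
      (x≢y ∷ base≢apex 1F x∈base ∷ base≢apex 2F x∈base ∷ [])
    ∷ (base≢apex 1F y∈base ∷ base≢apex 2F y∈base ∷ [])
    ∷ (apex-≢ (λ ()) ∷ [])
    ∷ [] ∷ []
  ... | inj₂ (a , refl) with b , b≢a , _ ← avoid-two a a with c , c≢a , c≢b ← avoid-two a b
    = a , x , apex a , apex b , apex c , ∁F≡ , ∁-facet (≢-sym b≢a) (≢-sym c≢a) (≢-sym c≢b) ,
      (x≢y ∷ base≢apex b x∈base ∷ base≢apex c x∈base ∷ [])
    ∷ (apex-≢ (≢-sym b≢a) ∷ apex-≢ (≢-sym c≢a) ∷ [])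
    ∷ (apex-≢ (≢-sym c≢b) ∷ [])
    ∷ [] ∷ []

  partner-facet : ∀ {F} → ∣ F ∣ ≡ suc d → F ∉ W d → ∃ λ a → MissDisjointPairs F (facet a)
  partner-facet {F} ∣F∣≡ F∉W with x , y , x≢y , ∁F≡ ← ∣p∣≡m⇒∁p≡⁅x⁆∪⁅y⁆ F ∣F∣≡ with base-or-apex x | base-or-apex y
  ... | inj₁ x∈base | _ = partner-facet-of-base-gap x∈base x≢y ∁F≡
  ... | inj₂ _ | inj₁ y∈base = partner-facet-of-base-gap y∈base (≢-sym x≢y) (trans ∁F≡ (∪-comm ⁅ x ⁆ ⁅ y ⁆))
  ... | inj₂ (a , refl) | inj₂ (b , refl) with c , c≢a , c≢b ← avoid-two a b =
    ⊥-elim (F∉W (subst (_∈ W d) (∁-injective (trans (∁-facet c≢a c≢b (x≢y ∘ cong apex)) (sym ∁F≡))) (facet∈W c)))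

mainTheorem2 : (d : ℕ) → 2 ≤ d →
    (¬ WeakHamPath d (W d) × ¬ WeakHamCycle d (W d)) ×
    ((F : Subset (3 + d)) → ∣ F ∣ ≡ suc d → F ∉ W d → WeakHamCycle d (WPlus d F))
mainTheorem2 d 2≤d = (no-weak-path d 1≤d , no-weak-cycle d 1≤d) , extension-cycle
  where
  1≤d : 1 ≤ d
  1≤d = ≤-trans (s≤s z≤n) 2≤d
  extension-cycle : (F : Subset (3 + d)) → ∣ F ∣ ≡ suc d → F ∉ W d → WeakHamCycle d (WPlus d F)
  extension-cycle F ∣F∣≡ F∉W with a , gaps ← partner-facet d ∣F∣≡ F∉W =
    two-windows-cycle d 2≤d (here refl) (there (facet∈W d a)) gaps
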